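{- In the setting below: (i) for all $v,u\in\overline\Sigma^+$, $v^\bullet\preceq u^\bullet$ in $\mathcal K$ if and only if $v\leqslant_L u$; (ii) if $x\in\Sigma^+$ and $|x|_{\underline\Sigma}>0$, then $x\leqslant_L w$ for every $w\in\overline\Sigma^+$.
   Context: Let $\mathcal K=(K;\preceq,\cdot,\backslash,/,\wedge,\vee,\top,\bot,{}^+)$ be an $\omega$PAL: $(K;\preceq,\wedge,\vee,\top,\bot)$ a bounded lattice, $\cdot$ associative, $b\preceq a\backslash c\iff a\cdot b\preceq c\iff a\preceq c/b$, and $a^+=\sup\{a^n\mid n\ge1\}$. Let $\overline\Sigma=\{\overline a\mid a\in K\}$ and $\underline\Sigma=\{\underline b\mid b\in K\}$ be two disjoint copies of $K$ as alphabets, $\Sigma=\overline\Sigma\cup\underline\Sigma$. For $w=\overline{a_1}\cdots\overline{a_n}\in\overline\Sigma^+$, $w^\bullet=a_1\cdot\ldots\cdot a_n$. $|x|_{\underline\Sigma}$ is the number of letters of $x$ from $\underline\Sigma$. $L=\{w\underline b\mid w\in\overline\Sigma^+,b\in K,w^\bullet\preceq b\}\cup\{x\in\Sigma^+\mid|x|_{\underline\Sigma}\ge2\}$. For $w_1,w_2\in\Sigma^+$, $w_1\leqslant_L w_2$ means: for all $x,y\in\Sigma^*$, $xw_2y\in L$ implies $xw_1y\in L$. -}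

module Defs where

open import Level using (Level; _⊔_)
open import Data.Nat using (ℕ; zero; suc; _≤_)
open import Data.List using (List; []; _∷_; _++_; [_])
open import Data.List.NonEmpty using (List⁺; _∷_; foldr₁; toList)
import Data.List.NonEmpty as List⁺
open import Data.Product using (Σ; _×_; ∃)
open import Data.Sum using (_⊎_)
open import Relation.Binary.Core using (Rel)
open import Relation.Binary.PropositionalEquality using (_≡_)
open import Relation.Binary.Structures using (IsPartialOrder)

-- power _·_ a n = a^(n+1)  (so n ranges over exponents ≥ 1)
power : ∀ {c} {A : Set c} → (A → A → A) → A → ℕ → A
power _·_ a zero    = a
power _·_ a (suc n) = power _·_ a n · a

record OmegaPAL (c ℓ : Level) : Set (Level.suc (c ⊔ ℓ)) where
  infixl 7 _·_
  infix 4 _≼_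
  field
    K      : Set c
    _≼_    : Rel K ℓ
    isPartialOrder : IsPartialOrder _≡_ _≼_
    _∧_ _∨_ : K → K → K
    ⊤ᴷ ⊥ᴷ  : K
    ∧-lb₁  : ∀ a b → a ∧ b ≼ a
    ∧-lb₂  : ∀ a b → a ∧ b ≼ b
    ∧-glb  : ∀ a b c → c ≼ a → c ≼ b → c ≼ a ∧ b
    ∨-ub₁  : ∀ a b → a ≼ a ∨ b
    ∨-ub₂  : ∀ a b → b ≼ a ∨ b
    ∨-lub  : ∀ a b c → a ≼ c → b ≼ c → a ∨ b ≼ c
    ⊤-max  : ∀ a → a ≼ ⊤ᴷ
    ⊥-min  : ∀ a → ⊥ᴷ ≼ a
    _·_    : K → K → K
    ·-assoc : ∀ a b c → (a · b) · c ≡ a · (b · c)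
    _\\_ _//_ : K → K → K
    resˡ-to   : ∀ a b c → b ≼ a \\ c → a · b ≼ c
    resˡ-from : ∀ a b c → a · b ≼ c → b ≼ a \\ c
    resʳ-to   : ∀ a b c → a ≼ c // b → a · b ≼ c
    resʳ-from : ∀ a b c → a · b ≼ c → a ≼ c // b
    _⁺     : K → K

    ⁺-ub   : ∀ a n → power _·_ a n ≼ a ⁺
    ⁺-lub  : ∀ a c → (∀ n → power _·_ a n ≼ c) → a ⁺ ≼ c

-- The alphabet Σ = overline-Σ ∪ underline-Σ (two disjoint copies of K).
data Letter {c} (K : Set c) : Set c where
  over  : K → Letter K
  under : K → Letter K

module Language {c ℓ} (𝒦 : OmegaPAL c ℓ) where
  open OmegaPAL 𝒦

  Word : Set c
  Word = List (Letter K)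

  -- embedding of  w ∈ overline-Σ⁺  (given as a nonempty list of elements of K)
  ⌜_⌝ : List⁺ K → Word
  ⌜ w ⌝ = Data.List.map over (toList w)

  _• : List⁺ K → K
  w • = foldr₁ _·_ w

  countUnder : Word → ℕ
  countUnder []             = zero
  countUnder (over _  ∷ x)  = countUnder x
  countUnder (under _ ∷ x)  = suc (countUnder x)

  InL : Word → Set (c ⊔ ℓ)
  InL x = (Σ (List⁺ K) λ w → Σ K λ b → (x ≡ ⌜ w ⌝ ++ [ under b ]) × (w • ≼ b))
        ⊎ (Lift′ (2 ≤ countUnder x))
    where
    Lift′ : Set → Set (c ⊔ ℓ)
    Lift′ A = Level.Lift (c ⊔ ℓ) A

  _⩽L_ : Word → Word → Set (c ⊔ ℓ)
  w₁ ⩽L w₂ = ∀ (x y : Word) → InL (x ++ w₂ ++ y) → InL (x ++ w₁ ++ y)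

{-# OPTIONS --safe #-}
module Submission where

-- The first part of L is recognised by a deterministic automaton whose state is the product of
-- the overlined letters read so far, and whose acceptance condition (a final underlined letter b
-- above that product) is upward closed in b and downward closed in the state. Replacing an
-- infix ⌜ u ⌝ by ⌜ v ⌝ with v• ≼ u• can only lower the state, since multiplication is monotone
-- in a residuated poset, so acceptance is preserved. Conversely, ⌜ u ⌝ followed by the underlined u•
-- is in L, and so is ⌜ v ⌝ followed by it only if v• ≼ u•. The second part of L only counts
-- underlined letters, and every word of L has at least one of them, which gives (ii).

open import Defs
open import Level using (Lift; lift)
open import Function using (id)
open import Data.Empty using (⊥; ⊥-elim)
open import Data.Nat using (suc; _<_; _≤_; _+_)
open import Data.Nat.Properties using (≤-reflexive; <⇒≤; <-irrefl; +-monoʳ-<; +-monoˡ-<; module ≤-Reasoning)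
open import Data.List using (List; []; _∷_; _++_; [_]; map; foldl)
open import Data.List.NonEmpty using (List⁺; _∷_; toList)
open import Data.Maybe using (Maybe; just; nothing)
open import Data.Maybe.Relation.Binary.Pointwise using (Pointwise; just; nothing)
open import Data.Product using (Σ; _×_; _,_)
open import Data.Sum using (inj₁; inj₂)
open import Function.Bundles using (_⇔_; mk⇔)
open import Relation.Binary.Structures using (IsPartialOrder)
open import Relation.Binary.PropositionalEquality
  using (_≡_; _≢_; refl; sym; trans; cong; subst; module ≡-Reasoning)

module Syntactic {c ℓ} (𝒦 : OmegaPAL c ℓ) where
  open OmegaPAL 𝒦
  open Language 𝒦
  open IsPartialOrder isPartialOrder using () renaming (refl to ≼-refl; trans to ≼-trans)

  ·-monoˡ-≼ : ∀ {a a′} d → a ≼ a′ → a · d ≼ a′ · d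
  ·-monoˡ-≼ {a} {a′} d p = resʳ-to a d (a′ · d) (≼-trans p (resʳ-from a′ d (a′ · d) ≼-refl))

  ·-monoʳ-≼ : ∀ {a a′} d → a ≼ a′ → d · a ≼ d · a′
  ·-monoʳ-≼ {a} {a′} d p = resˡ-to d a (d · a′) (≼-trans p (resˡ-from d a′ (d · a′) ≼-refl))

  -- Multiplication of K with a unit adjoined (nothing): the transition on an overlined letter.
  _⊙_ : Maybe K → K → Maybe K
  nothing ⊙ b = just b
  just a  ⊙ b = just (a · b)

  ⊙-assoc : ∀ m a b → (m ⊙ a) ⊙ b ≡ m ⊙ (a · b)
  ⊙-assoc nothing  a b = refl
  ⊙-assoc (just d) a b = cong just (·-assoc d a b)

  ⊙-monoˡ : ∀ {m m′} b → Pointwise _≼_ m m′ → Pointwise _≼_ (m ⊙ b) (m′ ⊙ b)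
  ⊙-monoˡ b nothing  = just ≼-refl
  ⊙-monoˡ b (just p) = just (·-monoˡ-≼ b p)

  ⊙-monoʳ : ∀ m {b b′} → b ≼ b′ → Pointwise _≼_ (m ⊙ b) (m ⊙ b′)
  ⊙-monoʳ nothing  p = just p
  ⊙-monoʳ (just a) p = just (·-monoʳ-≼ a p)

  foldl-⊙ : ∀ m a l → foldl _⊙_ m (a ∷ l) ≡ m ⊙ ((a ∷ l) •)
  foldl-⊙ m a []      = refl
  foldl-⊙ m a (b ∷ l) = begin
    foldl _⊙_ (m ⊙ a) (b ∷ l)  ≡⟨ foldl-⊙ (m ⊙ a) b l ⟩
    (m ⊙ a) ⊙ ((b ∷ l) •)      ≡⟨ ⊙-assoc m a ((b ∷ l) •) ⟩
    m ⊙ (a · (b ∷ l) •)        ∎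
    where open ≡-Reasoning

  Accepts : Maybe K → Word → Set ℓ
  Accepts m        []                = Lift ℓ ⊥
  Accepts m        (over a ∷ z)      = Accepts (m ⊙ a) z
  Accepts nothing  (under b ∷ z)     = Lift ℓ ⊥
  Accepts (just a) (under b ∷ [])    = a ≼ b
  Accepts (just a) (under b ∷ _ ∷ _) = Lift ℓ ⊥

  Accepts-map-over : ∀ m l y → Accepts m (map over l ++ y) ≡ Accepts (foldl _⊙_ m l) y
  Accepts-map-over m []      y = refl
  Accepts-map-over m (a ∷ l) y = Accepts-map-over (m ⊙ a) l y

  Accepts-⌜⌝ : ∀ m w y → Accepts m (⌜ w ⌝ ++ y) ≡ Accepts (m ⊙ (w •)) y
  Accepts-⌜⌝ m (a ∷ l) y = trans (Accepts-map-over m (a ∷ l) y) (cong (λ s → Accepts s y) (foldl-⊙ m a l))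

  Accepts-antitone : ∀ {m m′} → Pointwise _≼_ m m′ → ∀ z → Accepts m′ z → Accepts m z
  Accepts-antitone p        (over a ∷ z)      h = Accepts-antitone (⊙-monoˡ a p) z h
  Accepts-antitone (just p) (under b ∷ [])    h = ≼-trans p h
  Accepts-antitone _        []                (lift ())
  Accepts-antitone nothing  (under b ∷ z)     (lift ())
  Accepts-antitone (just p) (under b ∷ _ ∷ _) (lift ())

  Accepts-replace-infix : ∀ {v u} → v • ≼ u • → ∀ m x y → Accepts m (x ++ ⌜ u ⌝ ++ y) → Accepts m (x ++ ⌜ v ⌝ ++ y)
  Accepts-replace-infix {v} {u} p m [] y h =
    subst id (sym (Accepts-⌜⌝ m v y)) (Accepts-antitone (⊙-monoʳ m p) y (subst id (Accepts-⌜⌝ m u y) h))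
  Accepts-replace-infix p m        (over a ∷ x)       y h = Accepts-replace-infix p (m ⊙ a) x y h
  Accepts-replace-infix p nothing  (under b ∷ x)      y (lift ())
  Accepts-replace-infix p (just a) (under b ∷ [])     y (lift ())
  Accepts-replace-infix p (just a) (under b ∷ _ ∷ _)  y (lift ())

  Accepts-⌜⌝-under : ∀ w b → w • ≼ b → Accepts nothing (⌜ w ⌝ ++ [ under b ])
  Accepts-⌜⌝-under w b = subst id (sym (Accepts-⌜⌝ nothing w [ under b ]))

  Accepts⇒shape : ∀ m z → Accepts m z →
    Σ (List K) λ l → Σ K λ b → (z ≡ map over l ++ [ under b ]) × Accepts (foldl _⊙_ m l) [ under b ]
  Accepts⇒shape m (over a ∷ z) h with Accepts⇒shape (m ⊙ a) z h
  ... | l , b , refl , q = a ∷ l , b , refl , q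
  Accepts⇒shape (just a) (under b ∷ [])    h = [] , b , refl , h
  Accepts⇒shape m        []                (lift ())
  Accepts⇒shape nothing  (under b ∷ z)     (lift ())
  Accepts⇒shape (just a) (under b ∷ _ ∷ _) (lift ())

  Accepts⇒InL : ∀ z → Accepts nothing z → InL z
  Accepts⇒InL z h with Accepts⇒shape nothing z h
  ... | a ∷ l , b , eq , q = inj₁ (a ∷ l , b , eq , subst (λ s → Accepts s [ under b ]) (foldl-⊙ nothing a l) q)
  ... | []    , b , _  , lift ()

  countUnder-++ : ∀ x y → countUnder (x ++ y) ≡ countUnder x + countUnder y
  countUnder-++ []            y = refl
  countUnder-++ (over _ ∷ x)  y = countUnder-++ x y
  countUnder-++ (under _ ∷ x) y = cong suc (countUnder-++ x y)

  countUnder-map-over : ∀ l → countUnder (map over l) ≡ 0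
  countUnder-map-over []      = refl
  countUnder-map-over (_ ∷ l) = countUnder-map-over l

  countUnder-⌜⌝ : ∀ w → countUnder ⌜ w ⌝ ≡ 0
  countUnder-⌜⌝ w = countUnder-map-over (toList w)

  countUnder-⌜⌝-under : ∀ w b → countUnder (⌜ w ⌝ ++ [ under b ]) ≡ 1
  countUnder-⌜⌝-under w b = trans (countUnder-++ ⌜ w ⌝ [ under b ]) (cong (_+ 1) (countUnder-⌜⌝ w))

  countUnder-infix : ∀ x w y → countUnder (x ++ w ++ y) ≡ countUnder x + (countUnder w + countUnder y)
  countUnder-infix x w y = trans (countUnder-++ x (w ++ y)) (cong (countUnder x +_) (countUnder-++ w y))

  countUnder-cong-infix : ∀ {w w′} x y → countUnder w ≡ countUnder w′ → countUnder (x ++ w ++ y) ≡ countUnder (x ++ w′ ++ y)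
  countUnder-cong-infix {w} {w′} x y eq = begin
    countUnder (x ++ w ++ y)                      ≡⟨ countUnder-infix x w y ⟩
    countUnder x + (countUnder w + countUnder y)  ≡⟨ cong (λ k → countUnder x + (k + countUnder y)) eq ⟩
    countUnder x + (countUnder w′ + countUnder y) ≡⟨ sym (countUnder-infix x w′ y) ⟩
    countUnder (x ++ w′ ++ y)                     ∎
    where open ≡-Reasoning

  InL⇒1≤countUnder : ∀ {z} → InL z → 1 ≤ countUnder z
  InL⇒1≤countUnder (inj₁ (w , b , refl , _)) = ≤-reflexive (sym (countUnder-⌜⌝-under w b))
  InL⇒1≤countUnder (inj₂ (lift k))           = <⇒≤ k

  InL-⌜⌝-under⇒≼ : ∀ w b → InL (⌜ w ⌝ ++ [ under b ]) → w • ≼ b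
  InL-⌜⌝-under⇒≼ w b (inj₁ (w′ , b′ , eq , q)) =
    subst id (Accepts-⌜⌝ nothing w [ under b ]) (subst (Accepts nothing) (sym eq) (Accepts-⌜⌝-under w′ b′ q))
  InL-⌜⌝-under⇒≼ w b (inj₂ (lift k)) = ⊥-elim (<-irrefl refl (subst (1 <_) (countUnder-⌜⌝-under w b) k))

  •-mono⇒⩽L : ∀ v u → v • ≼ u • → ⌜ v ⌝ ⩽L ⌜ u ⌝
  •-mono⇒⩽L v u p x y (inj₁ (w , b , eq , q)) =
    Accepts⇒InL _ (Accepts-replace-infix p nothing x y (subst (Accepts nothing) (sym eq) (Accepts-⌜⌝-under w b q)))
  •-mono⇒⩽L v u p x y (inj₂ (lift k)) =
    inj₂ (lift (subst (2 ≤_) (countUnder-cong-infix x y (trans (countUnder-⌜⌝ u) (sym (countUnder-⌜⌝ v)))) k))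

  ⩽L⇒•-mono : ∀ v u → ⌜ v ⌝ ⩽L ⌜ u ⌝ → v • ≼ u •
  ⩽L⇒•-mono v u h = InL-⌜⌝-under⇒≼ v (u •) (h [] [ under (u •) ] (inj₁ (u , u • , refl , ≼-refl)))

  countUnder-<⇒⩽L : ∀ {x w} → countUnder w < countUnder x → x ⩽L w
  countUnder-<⇒⩽L {x} {w} w<x X Y h = inj₂ (lift (begin-strict
    1                                             ≤⟨ InL⇒1≤countUnder h ⟩
    countUnder (X ++ w ++ Y)                      ≡⟨ countUnder-infix X w Y ⟩
    countUnder X + (countUnder w + countUnder Y)  <⟨ +-monoʳ-< (countUnder X) (+-monoˡ-< (countUnder Y) w<x) ⟩
    countUnder X + (countUnder x + countUnder Y)  ≡⟨ countUnder-infix X x Y ⟨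
    countUnder (X ++ x ++ Y)                      ∎))
    where open ≤-Reasoning

lemma4 : ∀ {c ℓ} (𝒦 : OmegaPAL c ℓ) → let open OmegaPAL 𝒦 in let open Language 𝒦 in
    (∀ (v u : List⁺ K) → ((v •) ≼ (u •)) ⇔ (⌜ v ⌝ ⩽L ⌜ u ⌝))
    × (∀ (x : Word) → x ≢ [] → 0 < countUnder x → ∀ (w : List⁺ K) → x ⩽L ⌜ w ⌝)
lemma4 𝒦 =
    (λ v u → mk⇔ (•-mono⇒⩽L v u) (⩽L⇒•-mono v u))
  , (λ x _ 0<x w → countUnder-<⇒⩽L (subst (_< countUnder x) (sym (countUnder-⌜⌝ w)) 0<x))
  where
  open Language 𝒦 using (countUnder)
  open Syntactic 𝒦
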